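{- Let $n\ge 1$ and let $S_n$ be the symmetric group of degree $n$. The following are equivalent: (a) $\mathcal{P}_e(S_n)$ is a cograph; (b) $\mathcal{P}_e(S_n)$ is a chordal graph; (c) $n\le 5$.
   Context: For a finite group $G$, the enhanced power graph $\mathcal{P}_e(G)$ is the simple graph with vertex set $G$ in which two distinct vertices $x,y$ are adjacent if and only if $\langle x,y\rangle$ is cyclic. A graph is chordal if it has no induced cycle of length greater than $3$; it is a cograph if it has no induced subgraph isomorphic to the path $P_4$ on four vertices. -}

module Defs where

open import Data.Nat using (ℕ; suc; _+_; _%_)
open import Data.Fin using (Fin; toℕ)
open import Data.Fin.Permutation using (Permutation′; _⟨$⟩ʳ_; _∘ₚ_; id; flip)
open import Data.List using (List; []; _∷_)
open import Data.List.Membership.Propositional using (_∈_)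
open import Data.Product using (Σ; _×_)
open import Data.Sum using (_⊎_)
open import Relation.Nullary using (¬_)
open import Relation.Binary.PropositionalEquality using (_≡_)
open import Function.Bundles using (_⇔_)

record Graph : Set₁ where
  field
    V   : Set
    _≈_ : V → V → Set
    _~_ : V → V → Set

module _ (Γ : Graph) where
  open Graph Γ

  InducedP4 : Set
  InducedP4 = Σ V λ a → Σ V λ b → Σ V λ c → Σ V λ d →
    (¬ a ≈ b) × (¬ a ≈ c) × (¬ a ≈ d) × (¬ b ≈ c) × (¬ b ≈ d) × (¬ c ≈ d) ×
    (a ~ b) × (b ~ c) × (c ~ d) × (¬ a ~ c) × (¬ a ~ d) × (¬ b ~ d)

  IsCograph : Set
  IsCograph = ¬ InducedP4

  CycAdj : (k : ℕ) → .{{_ : Data.Nat.NonZero k}} → Fin k → Fin k → Set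
  CycAdj k i j = (toℕ j ≡ suc (toℕ i) % k) ⊎ (toℕ i ≡ suc (toℕ j) % k)

  InducedCycle : (k : ℕ) → .{{_ : Data.Nat.NonZero k}} → Set
  InducedCycle k = Σ (Fin k → V) λ v →
    (∀ i j → ¬ i ≡ j → ¬ v i ≈ v j) ×
    (∀ i j → (v i ~ v j) ⇔ CycAdj k i j)

  IsChordal : Set
  IsChordal = ∀ m → ¬ InducedCycle (4 + m)

Sym : ℕ → Set
Sym n = Permutation′ n

_≈ₚ_ : ∀ {n} → Sym n → Sym n → Set
π ≈ₚ σ = ∀ i → π ⟨$⟩ʳ i ≡ σ ⟨$⟩ʳ i

data ⟨_⟩ {n} (gs : List (Sym n)) : Sym n → Set where
  gen : ∀ {g h} → g ∈ gs → h ≈ₚ g → ⟨ gs ⟩ h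
  one : ∀ {h} → h ≈ₚ id → ⟨ gs ⟩ h
  inv : ∀ {g h} → ⟨ gs ⟩ g → h ≈ₚ flip g → ⟨ gs ⟩ h
  mul : ∀ {g g′ h} → ⟨ gs ⟩ g → ⟨ gs ⟩ g′ → h ≈ₚ (g ∘ₚ g′) → ⟨ gs ⟩ h

Cyclic⟨_,_⟩ : ∀ {n} → Sym n → Sym n → Set
Cyclic⟨ x , y ⟩ = Σ _ λ g → ⟨ x ∷ y ∷ [] ⟩ g ×
  (∀ h → ⟨ x ∷ y ∷ [] ⟩ h → ⟨ g ∷ [] ⟩ h)

EnhancedPowerGraphSym : ℕ → Graph
EnhancedPowerGraphSym n = record
  { V   = Sym n
  ; _≈_ = _≈ₚ_
  ; _~_ = λ x y → (¬ x ≈ₚ y) × Cyclic⟨ x , y ⟩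
  }

-- For n ≤ 5 every nontrivial element y of Sₙ lies in a greatest cyclic subgroup ⟨m⟩; for such
-- small n this is verified exhaustively against a list of the maximal cyclic subgroups.
-- If x ~ y ~ z with y ≠ 1, the cyclic groups ⟨x,y⟩ and ⟨y,z⟩ both lie in ⟨m⟩, so ⟨x,z⟩ is
-- cyclic: adjacency is transitive through every nontrivial vertex. The identity is adjacent to
-- everything, so the middle vertex of an induced P₄, or of an induced cycle of length ≥ 4,
-- would be nontrivial, and neither exists.
-- For n ≥ 6 the elements (4 5), (0 1 2), (3 5), (1 4 2), (0 5), (1 3 2) form an induced
-- hexagon: consecutive ones have disjoint supports and coprime orders, so both are powers of
-- their product, while non-consecutive ones do not commute. Its first four vertices form an
-- induced P₄.

module Submission where

open import Defs
open import Data.Bool using (if_then_else_; true; false)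
open import Data.Empty using (⊥-elim)
open import Data.Fin using (Fin; toℕ; fromℕ<; _↑ˡ_; _↑ʳ_; splitAt)
open import Data.Fin.Patterns using (0F; 1F; 2F; 3F; 4F; 5F)
open import Data.Fin.Permutation
  using (_⟨$⟩ʳ_; _⟨$⟩ˡ_; _∘ₚ_; id; flip; inverseˡ; inverseʳ; permutation; transpose)
open import Data.Fin.Properties using (all?; any?; _≟_; toℕ-fromℕ<; splitAt⁻¹-↑ˡ; splitAt⁻¹-↑ʳ)
open import Data.List using (List; []; _∷_)
open import Data.List.Membership.Propositional using (_∈_)
open import Data.List.Relation.Unary.All using (All; []; _∷_) renaming (all? to all?ᴬ; map to mapᴬ)
open import Data.List.Relation.Unary.Any using (here; there)
open import Data.Nat using (ℕ; zero; suc; _+_; _*_; _%_; _/_; _≤_; _≤?_; NonZero; s≤s)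
import Data.Nat.Properties as ℕ
open import Data.Nat.DivMod using (m≡m%n+[m/n]*n; m%n<n)
open import Data.Nat.Divisibility using (_∣_; divides)
open import Data.Nat.GCD using (gcd; gcd[m,n]∣m; gcd[m,n]∣n; gcd-GCD; module Bézout)
open import Data.Product using (Σ; _×_; _,_; proj₁; proj₂)
open import Data.Sum using (_⊎_; inj₁; inj₂)
open import Data.Unit using (tt)
open import Data.Vec using (Vec; []; _∷_; lookup; tabulate)
open import Data.Vec.Properties
  using (lookup∘tabulate; tabulate∘lookup; tabulate-cong) renaming (≡-dec to ≡-decᵛ)
open import Function.Bundles using (_⇔_; mk⇔; Equivalence)
open import Relation.Nullary using (¬_; Dec; yes; no; does; map′)
open import Relation.Nullary.Decidable using (True; toWitness; _×-dec_; _⊎-dec_; _→-dec_; ¬?)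
open import Relation.Binary.PropositionalEquality using (_≡_; refl; sym; trans; cong; subst)
open Relation.Binary.PropositionalEquality.≡-Reasoning

iterate : {A : Set} → (A → A) → ℕ → A → A
iterate f zero    x = x
iterate f (suc k) x = iterate f k (f x)

iterate-suc : {A : Set} (f : A → A) (k : ℕ) (x : A) → f (iterate f k x) ≡ iterate f (suc k) x
iterate-suc f zero    x = refl
iterate-suc f (suc k) x = iterate-suc f k (f x)

iterate-cong : {A : Set} {f g : A → A} → (∀ x → f x ≡ g x) → ∀ k x → iterate f k x ≡ iterate g k x
iterate-cong f≗g zero    x = refl
iterate-cong {f = f} f≗g (suc k) x = trans (cong (iterate f k) (f≗g x)) (iterate-cong f≗g k _)

module _ {n : ℕ} where

  infixr 25 _^_

  _^_ : Sym n → ℕ → Sym n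
  g ^ zero  = id
  g ^ suc k = g ∘ₚ g ^ k

  ^-iterate : ∀ g k i → g ^ k ⟨$⟩ʳ i ≡ iterate (g ⟨$⟩ʳ_) k i
  ^-iterate g zero    i = refl
  ^-iterate g (suc k) i = ^-iterate g k (g ⟨$⟩ʳ i)

  ^-+ : ∀ g a b → g ^ (a + b) ≈ₚ (g ^ a ∘ₚ g ^ b)
  ^-+ g zero    b i = refl
  ^-+ g (suc a) b i = ^-+ g a b (g ⟨$⟩ʳ i)

  ^-* : ∀ g a b → (g ^ a) ^ b ≈ₚ g ^ (b * a)
  ^-* g a zero    i = refl
  ^-* g a (suc b) i = trans (^-* g a b (g ^ a ⟨$⟩ʳ i)) (sym (^-+ g a (b * a) i))

  ^-cong : ∀ {g h : Sym n} k → g ≈ₚ h → g ^ k ≈ₚ h ^ k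
  ^-cong zero    e i = refl
  ^-cong {g} (suc k) e i = trans (cong (g ^ k ⟨$⟩ʳ_) (e i)) (^-cong k e _)

  id-^ : ∀ k → id ^ k ≈ₚ id {n}
  id-^ zero    i = refl
  id-^ (suc k) i = id-^ k i

  ^-*-order : ∀ {g : Sym n} o a → g ^ o ≈ₚ id → g ^ (a * o) ≈ₚ id
  ^-*-order {g} o a e i = trans (sym (^-* g o a i)) (trans (^-cong a e i) (id-^ a i))

  ^-mod : ∀ {g : Sym n} o .{{_ : NonZero o}} → g ^ o ≈ₚ id → ∀ a → g ^ a ≈ₚ g ^ (a % o)
  ^-mod {g} o e a i = begin
    g ^ a ⟨$⟩ʳ i                                ≡⟨ cong (λ c → g ^ c ⟨$⟩ʳ i) (m≡m%n+[m/n]*n a o) ⟩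
    g ^ (a % o + a / o * o) ⟨$⟩ʳ i              ≡⟨ ^-+ g (a % o) (a / o * o) i ⟩
    g ^ (a / o * o) ⟨$⟩ʳ (g ^ (a % o) ⟨$⟩ʳ i)  ≡⟨ ^-*-order o (a / o) e _ ⟩
    g ^ (a % o) ⟨$⟩ʳ i                          ∎

  _∈⟨_⟩ : Sym n → Sym n → Set
  h ∈⟨ g ⟩ = ⟨ g ∷ [] ⟩ h

  ∈-resp-≈ₚ : ∀ {gs : List (Sym n)} {h h′ : Sym n} → ⟨ gs ⟩ h → h′ ≈ₚ h → ⟨ gs ⟩ h′
  ∈-resp-≈ₚ p e = mul {g′ = id} p (one (λ _ → refl)) e

  ∈-first : ∀ {g : Sym n} {gs} → ⟨ g ∷ gs ⟩ g
  ∈-first = gen (here refl) (λ _ → refl)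

  ∈-second : ∀ {g h : Sym n} {gs} → ⟨ g ∷ h ∷ gs ⟩ h
  ∈-second = gen (there (here refl)) (λ _ → refl)

  ^-∈ : ∀ {gs : List (Sym n)} {g} k → ⟨ gs ⟩ g → ⟨ gs ⟩ (g ^ k)
  ^-∈ zero    p = one (λ _ → refl)
  ^-∈ (suc k) p = mul p (^-∈ k p) (λ _ → refl)

  ⟨⟩-⊆ : ∀ {gs hs : List (Sym n)} → (∀ {s} → s ∈ gs → ⟨ hs ⟩ s) → ∀ {h} → ⟨ gs ⟩ h → ⟨ hs ⟩ h
  ⟨⟩-⊆ f (gen s∈gs e) = ∈-resp-≈ₚ (f s∈gs) e
  ⟨⟩-⊆ f (one e)      = one e
  ⟨⟩-⊆ f (inv p e)    = inv (⟨⟩-⊆ f p) e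
  ⟨⟩-⊆ f (mul p q e)  = mul (⟨⟩-⊆ f p) (⟨⟩-⊆ f q) e

  ∈⟨⟩-trans : ∀ {k g h : Sym n} → k ∈⟨ g ⟩ → g ∈⟨ h ⟩ → k ∈⟨ h ⟩
  ∈⟨⟩-trans k∈⟨g⟩ g∈⟨h⟩ = ⟨⟩-⊆ (λ { (here refl) → g∈⟨h⟩ }) k∈⟨g⟩

  FiniteOrder : Sym n → Set
  FiniteOrder g = Σ ℕ λ o → g ^ suc o ≈ₚ id

  ∈⟨⟩⇒power : ∀ {g h : Sym n} → FiniteOrder g → h ∈⟨ g ⟩ → Σ ℕ λ a → h ≈ₚ g ^ a
  ∈⟨⟩⇒power _ (gen (here refl) e) = 1 , e
  ∈⟨⟩⇒power _ (one e)             = 0 , e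
  ∈⟨⟩⇒power {g} (o , g^o≈id) (inv {h′} p e) with ∈⟨⟩⇒power (o , g^o≈id) p
  ... | a , h′≈g^a = a * o , λ i → trans (e i) (sym (h′⁻¹≈g^ao i))
    where
    h′⁻¹≈g^ao : ∀ i → g ^ (a * o) ⟨$⟩ʳ i ≡ h′ ⟨$⟩ˡ i
    h′⁻¹≈g^ao i = begin
      g ^ (a * o) ⟨$⟩ʳ i                     ≡⟨ cong (g ^ (a * o) ⟨$⟩ʳ_) (sym (inverseʳ h′)) ⟩
      g ^ (a * o) ⟨$⟩ʳ (h′ ⟨$⟩ʳ j)           ≡⟨ cong (g ^ (a * o) ⟨$⟩ʳ_) (h′≈g^a j) ⟩
      g ^ (a * o) ⟨$⟩ʳ (g ^ a ⟨$⟩ʳ j)        ≡⟨ ^-+ g a (a * o) j ⟨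
      g ^ (a + a * o) ⟨$⟩ʳ j                 ≡⟨ cong (λ c → g ^ c ⟨$⟩ʳ j) (ℕ.*-suc a o) ⟨
      g ^ (a * suc o) ⟨$⟩ʳ j                 ≡⟨ ^-*-order (suc o) a g^o≈id j ⟩
      j                                      ∎
      where j = h′ ⟨$⟩ˡ i
  ∈⟨⟩⇒power {g} ord (mul p q e) with ∈⟨⟩⇒power ord p | ∈⟨⟩⇒power ord q
  ... | a , e₁ | b , e₂ = a + b , λ i →
    trans (e i) (trans (e₂ _) (trans (cong (g ^ b ⟨$⟩ʳ_) (e₁ i)) (sym (^-+ g a b i))))

  ∈⟨⟩⇒power< : ∀ {g h : Sym n} o → g ^ suc o ≈ₚ id → h ∈⟨ g ⟩ →
    Σ (Fin (suc o)) λ b → h ≈ₚ g ^ toℕ b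
  ∈⟨⟩⇒power< {g} {h} o g^o≈id h∈⟨g⟩ with ∈⟨⟩⇒power (o , g^o≈id) h∈⟨g⟩
  ... | a , h≈g^a = fromℕ< a%o<o , λ i → begin
    h ⟨$⟩ʳ i                          ≡⟨ h≈g^a i ⟩
    g ^ a ⟨$⟩ʳ i                      ≡⟨ ^-mod (suc o) g^o≈id a i ⟩
    g ^ (a % suc o) ⟨$⟩ʳ i            ≡⟨ cong (λ c → g ^ c ⟨$⟩ʳ i) (toℕ-fromℕ< a%o<o) ⟨
    g ^ toℕ (fromℕ< a%o<o) ⟨$⟩ʳ i     ∎
    where a%o<o = m%n<n a (suc o)

  Commute : Sym n → Sym n → Set
  Commute x y = (x ∘ₚ y) ≈ₚ (y ∘ₚ x)

  ⟨⟩-commute : ∀ {gs : List (Sym n)} {c} →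
    (∀ {s} → s ∈ gs → Commute s c) → ∀ {h} → ⟨ gs ⟩ h → Commute h c
  ⟨⟩-commute {c = c} f (gen s∈gs e) i =
    trans (cong (c ⟨$⟩ʳ_) (e i)) (trans (f s∈gs i) (sym (e (c ⟨$⟩ʳ i))))
  ⟨⟩-commute {c = c} f (one e) i = trans (cong (c ⟨$⟩ʳ_) (e i)) (sym (e (c ⟨$⟩ʳ i)))
  ⟨⟩-commute {c = c} f (inv {g} {h} p e) i = begin
    c ⟨$⟩ʳ (h ⟨$⟩ʳ i)                      ≡⟨ cong (c ⟨$⟩ʳ_) (e i) ⟩
    c ⟨$⟩ʳ (g ⟨$⟩ˡ i)                      ≡⟨ inverseˡ g ⟨
    g ⟨$⟩ˡ (g ⟨$⟩ʳ (c ⟨$⟩ʳ (g ⟨$⟩ˡ i)))    ≡⟨ cong (g ⟨$⟩ˡ_) (⟨⟩-commute {c = c} f p (g ⟨$⟩ˡ i)) ⟨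
    g ⟨$⟩ˡ (c ⟨$⟩ʳ (g ⟨$⟩ʳ (g ⟨$⟩ˡ i)))    ≡⟨ cong (λ j → g ⟨$⟩ˡ (c ⟨$⟩ʳ j)) (inverseʳ g) ⟩
    g ⟨$⟩ˡ (c ⟨$⟩ʳ i)                      ≡⟨ e (c ⟨$⟩ʳ i) ⟨
    h ⟨$⟩ʳ (c ⟨$⟩ʳ i)                      ∎
  ⟨⟩-commute {c = c} f (mul {g} {g′} {h} p q e) i = begin
    c ⟨$⟩ʳ (h ⟨$⟩ʳ i)                      ≡⟨ cong (c ⟨$⟩ʳ_) (e i) ⟩
    c ⟨$⟩ʳ (g′ ⟨$⟩ʳ (g ⟨$⟩ʳ i))            ≡⟨ ⟨⟩-commute {c = c} f q (g ⟨$⟩ʳ i) ⟩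
    g′ ⟨$⟩ʳ (c ⟨$⟩ʳ (g ⟨$⟩ʳ i))            ≡⟨ cong (g′ ⟨$⟩ʳ_) (⟨⟩-commute {c = c} f p i) ⟩
    g′ ⟨$⟩ʳ (g ⟨$⟩ʳ (c ⟨$⟩ʳ i))            ≡⟨ e (c ⟨$⟩ʳ i) ⟨
    h ⟨$⟩ʳ (c ⟨$⟩ʳ i)                      ∎

  cyclic⇒commute : ∀ {x y : Sym n} → Cyclic⟨ x , y ⟩ → Commute x y
  cyclic⇒commute {x} {y} (w , _ , ⟨x,y⟩⊆⟨w⟩) = ⟨⟩-commute {c = y} w-commutes-y x∈⟨w⟩
    where
    x∈⟨w⟩ = ⟨x,y⟩⊆⟨w⟩ x ∈-first
    y∈⟨w⟩ = ⟨x,y⟩⊆⟨w⟩ y ∈-second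
    w-commutes-y : ∀ {s} → s ∈ w ∷ [] → Commute s y
    w-commutes-y (here refl) i = sym (⟨⟩-commute {c = w} (λ { (here refl) _ → refl }) y∈⟨w⟩ i)

  cyclic-intro : ∀ {x y w : Sym n} → ⟨ x ∷ y ∷ [] ⟩ w → x ∈⟨ w ⟩ → y ∈⟨ w ⟩ → Cyclic⟨ x , y ⟩
  cyclic-intro {w = w} w∈⟨x,y⟩ x∈⟨w⟩ y∈⟨w⟩ = w , w∈⟨x,y⟩ , λ _ → ⟨⟩-⊆ λ
    { (here refl) → x∈⟨w⟩ ; (there (here refl)) → y∈⟨w⟩ }

  power-^ : ∀ {x w : Sym n} p k → x ≈ₚ w ^ p → x ^ k ≈ₚ w ^ (k * p)
  power-^ {w = w} p k e i = trans (^-cong k e i) (^-* w p k i)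

  power-from-bézout : ∀ {x z w : Sym n} p q u v → x ≈ₚ w ^ p → z ≈ₚ w ^ q → ∀ d →
    d + v * q ≡ u * p → w ^ d ≈ₚ (x ^ u ∘ₚ flip (z ^ v))
  power-from-bézout {x} {z} {w} p q u v x≈ z≈ d eq i = begin
    w ^ d ⟨$⟩ʳ i                                  ≡⟨ inverseˡ (z ^ v) ⟨
    z ^ v ⟨$⟩ˡ (z ^ v ⟨$⟩ʳ (w ^ d ⟨$⟩ʳ i))        ≡⟨ cong (z ^ v ⟨$⟩ˡ_) z^v∘w^d≈x^u ⟩
    z ^ v ⟨$⟩ˡ (x ^ u ⟨$⟩ʳ i)                     ∎
    where
    z^v∘w^d≈x^u : z ^ v ⟨$⟩ʳ (w ^ d ⟨$⟩ʳ i) ≡ x ^ u ⟨$⟩ʳ i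
    z^v∘w^d≈x^u = begin
      z ^ v ⟨$⟩ʳ (w ^ d ⟨$⟩ʳ i)        ≡⟨ power-^ q v z≈ _ ⟩
      w ^ (v * q) ⟨$⟩ʳ (w ^ d ⟨$⟩ʳ i)  ≡⟨ ^-+ w d (v * q) i ⟨
      w ^ (d + v * q) ⟨$⟩ʳ i           ≡⟨ cong (λ c → w ^ c ⟨$⟩ʳ i) eq ⟩
      w ^ (u * p) ⟨$⟩ʳ i               ≡⟨ power-^ p u x≈ i ⟨
      x ^ u ⟨$⟩ʳ i                     ∎

  cyclic-of-powers : ∀ {x z w : Sym n} p q → x ≈ₚ w ^ p → z ≈ₚ w ^ q → Cyclic⟨ x , z ⟩
  cyclic-of-powers {x} {z} {w} p q x≈ z≈ =
    cyclic-intro w^d∈⟨x,z⟩ (∈⟨w^d⟩ (gcd[m,n]∣m p q) x≈) (∈⟨w^d⟩ (gcd[m,n]∣n p q) z≈)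
    where
    d = gcd p q
    ∈⟨w^d⟩ : ∀ {y r} → d ∣ r → y ≈ₚ w ^ r → y ∈⟨ w ^ d ⟩
    ∈⟨w^d⟩ {y} (divides k refl) y≈ =
      ∈-resp-≈ₚ (^-∈ k ∈-first) λ i → trans (y≈ i) (sym (^-* w d k i))
    w^d∈⟨x,z⟩ : ⟨ x ∷ z ∷ [] ⟩ (w ^ d)
    w^d∈⟨x,z⟩ with Bézout.identity (gcd-GCD p q)
    ... | Bézout.+- u v eq = mul {g′ = flip (z ^ v)} (^-∈ u ∈-first) (inv (^-∈ v ∈-second) (λ _ → refl))
                                 (power-from-bézout p q u v x≈ z≈ d eq)
    ... | Bézout.-+ u v eq = mul {g′ = flip (x ^ u)} (^-∈ v ∈-second) (inv (^-∈ u ∈-first) (λ _ → refl))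
                                 (power-from-bézout q p v u z≈ x≈ d eq)

  cyclic-within-cyclic : ∀ {x z w : Sym n} → FiniteOrder w → x ∈⟨ w ⟩ → z ∈⟨ w ⟩ → Cyclic⟨ x , z ⟩
  cyclic-within-cyclic ord x∈ z∈ with ∈⟨⟩⇒power ord x∈ | ∈⟨⟩⇒power ord z∈
  ... | p , x≈ | q , z≈ = cyclic-of-powers p q x≈ z≈

module _ (Γ : Graph) where
  open Graph Γ

  Dominating : V → Set
  Dominating z = ∀ x → ¬ z ≈ x → z ~ x

  TransitiveOffDominating : Set
  TransitiveOffDominating = ∀ {x y z} → ¬ Dominating y → x ~ y → y ~ z → ¬ x ≈ z → x ~ z

  transitiveOffDominating⇒cograph : TransitiveOffDominating → IsCograph Γ
  transitiveOffDominating⇒cograph trans~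
    (a , b , c , d , _ , a≉c , _ , _ , b≉d , _ , a~b , b~c , _ , a≁c , _ , b≁d) =
    a≁c (trans~ (λ b-dom → b≁d (b-dom d b≉d)) a~b b~c a≉c)

  cycle-adjacent : ∀ {k} .{{_ : NonZero k}} (C : InducedCycle Γ k) {i j} →
    CycAdj Γ k i j → proj₁ C i ~ proj₁ C j
  cycle-adjacent (_ , _ , adjacent) = adjacent _ _ .Equivalence.from

  cycle-nonadjacent : ∀ {k} .{{_ : NonZero k}} (C : InducedCycle Γ k) {i j} →
    ¬ CycAdj Γ k i j → ¬ proj₁ C i ~ proj₁ C j
  cycle-nonadjacent (_ , _ , adjacent) ¬adj a = ¬adj (adjacent _ _ .Equivalence.to a)

  -- 4 % (4 + m) only reduces once m is split.
  ¬cycAdj-1-3 : ∀ m → ¬ CycAdj Γ (4 + m) 1F 3F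
  ¬cycAdj-1-3 zero    (inj₁ ())
  ¬cycAdj-1-3 zero    (inj₂ ())
  ¬cycAdj-1-3 (suc _) (inj₁ ())
  ¬cycAdj-1-3 (suc _) (inj₂ ())

  transitiveOffDominating⇒chordal : TransitiveOffDominating → IsChordal Γ
  transitiveOffDominating⇒chordal trans~ m C@(v , distinct , _) =
    cycle-nonadjacent C (λ { (inj₁ ()) ; (inj₂ ()) })
      (trans~ v₁-not-dominating (cycle-adjacent C (inj₁ refl)) (cycle-adjacent C (inj₁ refl))
              (distinct 0F 2F λ ()))
    where
    v₁-not-dominating : ¬ Dominating (v 1F)
    v₁-not-dominating v₁-dom = cycle-nonadjacent C (¬cycAdj-1-3 m) (v₁-dom (v 3F) (distinct 1F 3F λ ()))

  inducedCycle⇒P4 : ∀ m → InducedCycle Γ (5 + m) → InducedP4 Γ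
  inducedCycle⇒P4 m C@(v , distinct , _) =
    v 0F , v 1F , v 2F , v 3F ,
    distinct 0F 1F (λ ()) , distinct 0F 2F (λ ()) , distinct 0F 3F (λ ()) ,
    distinct 1F 2F (λ ()) , distinct 1F 3F (λ ()) , distinct 2F 3F (λ ()) ,
    cycle-adjacent C (inj₁ refl) , cycle-adjacent C (inj₁ refl) , cycle-adjacent C (inj₁ refl) ,
    cycle-nonadjacent C (λ { (inj₁ ()) ; (inj₂ ()) }) ,
    cycle-nonadjacent C (λ { (inj₁ ()) ; (inj₂ ()) }) ,
    cycle-nonadjacent C (λ { (inj₁ ()) ; (inj₂ ()) })

module _ {n : ℕ} where
  private
    EPG = EnhancedPowerGraphSym n
  open Graph EPG using (_~_)

  identity-dominating : ∀ {e : Sym n} → e ≈ₚ id → Dominating EPG e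
  identity-dominating e≈id x e≉x = e≉x , cyclic-intro ∈-second (one e≈id) ∈-first

  GreatestCyclicAbove : Sym n → Sym n → Set
  GreatestCyclicAbove m y = ∀ g → y ∈⟨ g ⟩ → g ∈⟨ m ⟩

  transitive-if-greatestCyclic :
    (∀ y → ¬ y ≈ₚ id → Σ (Sym n) λ m → FiniteOrder m × GreatestCyclicAbove m y) →
    TransitiveOffDominating EPG
  transitive-if-greatestCyclic greatest {x} {y} {z} y-not-dom
    (_ , g , _ , ⟨x,y⟩⊆⟨g⟩) (_ , h , _ , ⟨y,z⟩⊆⟨h⟩) x≉z
    with greatest y (λ y≈id → y-not-dom (identity-dominating y≈id))
  ... | m , ord , m-greatest = x≉z , cyclic-within-cyclic ord
    (∈⟨⟩-trans (⟨x,y⟩⊆⟨g⟩ x ∈-first) (m-greatest g (⟨x,y⟩⊆⟨g⟩ y ∈-second)))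
    (∈⟨⟩-trans (⟨y,z⟩⊆⟨h⟩ z ∈-second) (m-greatest h (⟨y,z⟩⊆⟨h⟩ y ∈-first)))

  adjacent-if-powers-of-product : ∀ {x y : Sym n} a b → ¬ x ≈ₚ y →
    x ≈ₚ (x ∘ₚ y) ^ a → y ≈ₚ (x ∘ₚ y) ^ b → x ~ y
  adjacent-if-powers-of-product a b x≉y x≈ y≈ = x≉y , cyclic-intro
    (mul ∈-first ∈-second (λ _ → refl))
    (∈-resp-≈ₚ (^-∈ a ∈-first) x≈)
    (∈-resp-≈ₚ (^-∈ b ∈-first) y≈)

  nonadjacent-if-not-commute : ∀ {x y : Sym n} → ¬ Commute x y → ¬ x ~ y
  nonadjacent-if-not-commute ¬comm (_ , cyc) = ¬comm (cyclic⇒commute cyc)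

∀-vec? : ∀ {m} k {P : Vec (Fin m) k → Set} → (∀ v → Dec (P v)) → Dec (∀ v → P v)
∀-vec? zero    P? = map′ (λ p → λ { [] → p }) (λ ∀P → ∀P []) (P? [])
∀-vec? (suc k) P? = map′ (λ ∀P → λ { (a ∷ v) → ∀P a v }) (λ ∀P a v → ∀P (a ∷ v))
  (all? λ a → ∀-vec? k λ v → P? (a ∷ v))

Table : ℕ → Set
Table n = Vec (Fin n) n

module _ {n : ℕ} where

  idᵗ : Table n
  idᵗ = tabulate (λ i → i)

  infixr 25 _^ᵗ_
  infix 4 _≟ᵗ_

  _^ᵗ_ : Table n → ℕ → Table n
  t ^ᵗ k = tabulate (iterate (lookup t) k)

  _≟ᵗ_ : (s t : Table n) → Dec (s ≡ t)
  _≟ᵗ_ = ≡-decᵛ _≟_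

  tab : Sym n → Table n
  tab g = tabulate (g ⟨$⟩ʳ_)

  tab-cong : ∀ {x y : Sym n} → x ≈ₚ y → tab x ≡ tab y
  tab-cong = tabulate-cong

  tab-injective : ∀ {x y : Sym n} → tab x ≡ tab y → x ≈ₚ y
  tab-injective {x} {y} eq i = begin
    x ⟨$⟩ʳ i              ≡⟨ lookup∘tabulate (x ⟨$⟩ʳ_) i ⟨
    lookup (tab x) i      ≡⟨ cong (λ t → lookup t i) eq ⟩
    lookup (tab y) i      ≡⟨ lookup∘tabulate (y ⟨$⟩ʳ_) i ⟩
    y ⟨$⟩ʳ i              ∎

  tab-^ : ∀ g k → tab (g ^ k) ≡ tab g ^ᵗ k
  tab-^ g k = tabulate-cong λ i →
    trans (^-iterate g k i) (iterate-cong (λ j → sym (lookup∘tabulate (g ⟨$⟩ʳ_) j)) k i)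

  tab-power : ∀ {g y : Sym n} b → y ≈ₚ g ^ b → tab y ≡ tab g ^ᵗ b
  tab-power {g} {y} b y≈g^b = trans (tab-cong {y} {g ^ b} y≈g^b) (tab-^ g b)

  iterate-order : ∀ {t : Table n} o → t ^ᵗ o ≡ idᵗ → ∀ i → iterate (lookup t) o i ≡ i
  iterate-order {t} o t^o≡id i = begin
    iterate (lookup t) o i   ≡⟨ lookup∘tabulate (iterate (lookup t) o) i ⟨
    lookup (t ^ᵗ o) i        ≡⟨ cong (λ s → lookup s i) t^o≡id ⟩
    lookup idᵗ i             ≡⟨ lookup∘tabulate (λ j → j) i ⟩
    i                        ∎

  HasOrderᵗ : Table n → Set
  HasOrderᵗ t = Σ ℕ λ o → t ^ᵗ suc o ≡ idᵗ

  idᵗ-hasOrder : HasOrderᵗ idᵗ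
  idᵗ-hasOrder = 0 , tabulate-cong (lookup∘tabulate (λ i → i))

  fromTable : (t : Table n) → HasOrderᵗ t → Sym n
  fromTable t (o , t^o≡id) = permutation (lookup t) (iterate (lookup t) o)
    (λ i → trans (iterate-suc (lookup t) o i) (iterate-order {t} (suc o) t^o≡id i))
    (iterate-order {t} (suc o) t^o≡id)

  tab-fromTable : ∀ t ord → tab (fromTable t ord) ≡ t
  tab-fromTable t _ = tabulate∘lookup t

  order-from-table : ∀ {g : Sym n} o → tab g ^ᵗ o ≡ idᵗ → g ^ o ≈ₚ id
  order-from-table {g} o g^o≡id = tab-injective {g ^ o} {id} (trans (tab-^ g o) g^o≡id)

  fromTable-finiteOrder : ∀ t ord → FiniteOrder (fromTable t ord)
  fromTable-finiteOrder t (o , t^o≡id) =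
    o , order-from-table (suc o) (trans (cong (_^ᵗ suc o) (tab-fromTable t (o , t^o≡id))) t^o≡id)

  Injectiveᵗ : Table n → Set
  Injectiveᵗ t = ∀ i j → lookup t i ≡ lookup t j → i ≡ j

  injectiveᵗ? : ∀ t → Dec (Injectiveᵗ t)
  injectiveᵗ? t = all? λ i → all? λ j → (lookup t i ≟ lookup t j) →-dec (i ≟ j)

  tab-injectiveᵗ : ∀ g → Injectiveᵗ (tab g)
  tab-injectiveᵗ g i j eq = begin
    i                          ≡⟨ inverseˡ g ⟨
    g ⟨$⟩ˡ (g ⟨$⟩ʳ i)          ≡⟨ cong (g ⟨$⟩ˡ_) g-i≡g-j ⟩
    g ⟨$⟩ˡ (g ⟨$⟩ʳ j)          ≡⟨ inverseˡ g ⟩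
    j                          ∎
    where
    g-i≡g-j : g ⟨$⟩ʳ i ≡ g ⟨$⟩ʳ j
    g-i≡g-j = trans (sym (lookup∘tabulate _ i)) (trans eq (lookup∘tabulate _ j))

  rootᵗ : ℕ → List (Table n) → Table n → Table n
  rootᵗ e []       y = idᵗ
  rootᵗ e (t ∷ ts) y = if does (any? {n = e} λ k → t ^ᵗ toℕ k ≟ᵗ y) then t else rootᵗ e ts y

  rootᵗ-hasOrder : ∀ e gens → All HasOrderᵗ gens → ∀ y → HasOrderᵗ (rootᵗ e gens y)
  rootᵗ-hasOrder e []       []         y = idᵗ-hasOrder
  rootᵗ-hasOrder e (t ∷ ts) (ord ∷ os) y with does (any? {n = e} λ k → t ^ᵗ toℕ k ≟ᵗ y)
  ... | true  = ord
  ... | false = rootᵗ-hasOrder e ts os y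

-- gens should list a generator of each maximal cyclic subgroup of Sₙ. Validity is decided by
-- running through all tables: each permutation g has order at most e, and g is a power of the
-- generator that rootᵗ finds for each nontrivial power of g.
module Certificate {n : ℕ} (e : ℕ) (gens : List (Table n)) where

  BoundedOrderᵗ : Table n → Set
  BoundedOrderᵗ t = Σ (Fin e) λ o → t ^ᵗ suc (toℕ o) ≡ idᵗ

  PowerOfRoot : Table n → ℕ → Set
  PowerOfRoot t b = t ^ᵗ b ≡ idᵗ ⊎ Σ (Fin e) λ k → rootᵗ e gens (t ^ᵗ b) ^ᵗ toℕ k ≡ t

  Certified : Table n → Set
  Certified t = Σ (Fin e) λ o →
    t ^ᵗ suc (toℕ o) ≡ idᵗ × ∀ (b : Fin (suc (toℕ o))) → PowerOfRoot t (toℕ b)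

  Valid : Set
  Valid = All BoundedOrderᵗ gens × ∀ t → Injectiveᵗ t → Certified t

  valid? : Dec Valid
  valid? = all?ᴬ (λ t → any? λ o → t ^ᵗ suc (toℕ o) ≟ᵗ idᵗ) gens ×-dec
    ∀-vec? n λ t → injectiveᵗ? t →-dec (any? λ o → (t ^ᵗ suc (toℕ o) ≟ᵗ idᵗ) ×-dec
      all? λ b → (t ^ᵗ toℕ b ≟ᵗ idᵗ) ⊎-dec any? λ k → rootᵗ e gens (t ^ᵗ toℕ b) ^ᵗ toℕ k ≟ᵗ t)

  module _ (valid : Valid) where

    root-hasOrder : ∀ y → HasOrderᵗ (rootᵗ e gens y)
    root-hasOrder = rootᵗ-hasOrder e gens (mapᴬ (λ { (o , eq) → toℕ o , eq }) (proj₁ valid))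

    root : Sym n → Sym n
    root y = fromTable (rootᵗ e gens (tab y)) (root-hasOrder (tab y))

    certified : ∀ g → Certified (tab g)
    certified g = proj₂ valid (tab g) (tab-injectiveᵗ g)

    root-power : ∀ {g y} b k → y ≈ₚ g ^ b → rootᵗ e gens (tab g ^ᵗ b) ^ᵗ k ≡ tab g → g ≈ₚ root y ^ k
    root-power {g} {y} b k y≈g^b r^k≡g = tab-injective {x = g} {y = root y ^ k} (begin
      tab g                            ≡⟨ r^k≡g ⟨
      rootᵗ e gens (tab g ^ᵗ b) ^ᵗ k   ≡⟨ cong (λ t → rootᵗ e gens t ^ᵗ k) (tab-power {g = g} {y = y} b y≈g^b) ⟨
      rootᵗ e gens (tab y) ^ᵗ k        ≡⟨ cong (_^ᵗ k) (tab-fromTable (rootᵗ e gens (tab y)) (root-hasOrder (tab y))) ⟨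
      tab (root y) ^ᵗ k                ≡⟨ tab-^ (root y) k ⟨
      tab (root y ^ k)                 ∎)

    root-greatest : ∀ y → ¬ y ≈ₚ id → GreatestCyclicAbove (root y) y
    root-greatest y y≉id g y∈⟨g⟩ with certified g
    ... | o , g^o≡id , powers with ∈⟨⟩⇒power< (toℕ o) (order-from-table (suc (toℕ o)) g^o≡id) y∈⟨g⟩
    ... | b , y≈g^b with powers b
    ... | inj₁ g^b≡id = ⊥-elim (y≉id λ i → trans (y≈g^b i) (order-from-table {g = g} (toℕ b) g^b≡id i))
    ... | inj₂ (k , r^k≡g) = ∈-resp-≈ₚ (^-∈ (toℕ k) ∈-first) (root-power {g} {y} (toℕ b) (toℕ k) y≈g^b r^k≡g)

    greatestCyclic : ∀ y → ¬ y ≈ₚ id → Σ (Sym n) λ m → FiniteOrder m × GreatestCyclicAbove m y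
    greatestCyclic y y≉id =
      root y , fromTable-finiteOrder (rootᵗ e gens (tab y)) (root-hasOrder (tab y)) , root-greatest y y≉id

    transitiveOffDominating : TransitiveOffDominating (EnhancedPowerGraphSym n)
    transitiveOffDominating = transitive-if-greatestCyclic greatestCyclic

-- Element orders in Sₙ, n ≤ 5, are at most 6, so exponents below 7 suffice.
byCertificate : ∀ {n} (gens : List (Table n)) → {True (Certificate.valid? 7 gens)} →
  TransitiveOffDominating (EnhancedPowerGraphSym n)
byCertificate gens {valid} = Certificate.transitiveOffDominating 7 gens (toWitness valid)

maximalCyclicGenerators₀ : List (Table 0)
maximalCyclicGenerators₀ = []

maximalCyclicGenerators₁ : List (Table 1)
maximalCyclicGenerators₁ = []

maximalCyclicGenerators₂ : List (Table 2)
maximalCyclicGenerators₂ =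
  (1F ∷ 0F ∷ []) ∷
  []

maximalCyclicGenerators₃ : List (Table 3)
maximalCyclicGenerators₃ =
  (0F ∷ 2F ∷ 1F ∷ []) ∷
  (1F ∷ 0F ∷ 2F ∷ []) ∷
  (1F ∷ 2F ∷ 0F ∷ []) ∷
  (2F ∷ 1F ∷ 0F ∷ []) ∷
  []

maximalCyclicGenerators₄ : List (Table 4)
maximalCyclicGenerators₄ =
  (0F ∷ 1F ∷ 3F ∷ 2F ∷ []) ∷
  (0F ∷ 2F ∷ 1F ∷ 3F ∷ []) ∷
  (0F ∷ 2F ∷ 3F ∷ 1F ∷ []) ∷
  (0F ∷ 3F ∷ 2F ∷ 1F ∷ []) ∷
  (1F ∷ 0F ∷ 2F ∷ 3F ∷ []) ∷
  (1F ∷ 2F ∷ 0F ∷ 3F ∷ []) ∷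
  (1F ∷ 2F ∷ 3F ∷ 0F ∷ []) ∷
  (1F ∷ 3F ∷ 0F ∷ 2F ∷ []) ∷
  (1F ∷ 3F ∷ 2F ∷ 0F ∷ []) ∷
  (2F ∷ 1F ∷ 0F ∷ 3F ∷ []) ∷
  (2F ∷ 1F ∷ 3F ∷ 0F ∷ []) ∷
  (2F ∷ 3F ∷ 1F ∷ 0F ∷ []) ∷
  (3F ∷ 1F ∷ 2F ∷ 0F ∷ []) ∷
  []

maximalCyclicGenerators₅ : List (Table 5)
maximalCyclicGenerators₅ =
  (0F ∷ 2F ∷ 3F ∷ 4F ∷ 1F ∷ []) ∷
  (0F ∷ 2F ∷ 4F ∷ 1F ∷ 3F ∷ []) ∷
  (0F ∷ 3F ∷ 4F ∷ 2F ∷ 1F ∷ []) ∷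
  (1F ∷ 0F ∷ 3F ∷ 4F ∷ 2F ∷ []) ∷
  (1F ∷ 2F ∷ 0F ∷ 4F ∷ 3F ∷ []) ∷
  (1F ∷ 2F ∷ 3F ∷ 0F ∷ 4F ∷ []) ∷
  (1F ∷ 2F ∷ 3F ∷ 4F ∷ 0F ∷ []) ∷
  (1F ∷ 2F ∷ 4F ∷ 0F ∷ 3F ∷ []) ∷
  (1F ∷ 2F ∷ 4F ∷ 3F ∷ 0F ∷ []) ∷
  (1F ∷ 3F ∷ 0F ∷ 2F ∷ 4F ∷ []) ∷
  (1F ∷ 3F ∷ 0F ∷ 4F ∷ 2F ∷ []) ∷
  (1F ∷ 3F ∷ 2F ∷ 4F ∷ 0F ∷ []) ∷
  (1F ∷ 3F ∷ 4F ∷ 0F ∷ 2F ∷ []) ∷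
  (1F ∷ 3F ∷ 4F ∷ 2F ∷ 0F ∷ []) ∷
  (1F ∷ 4F ∷ 0F ∷ 2F ∷ 3F ∷ []) ∷
  (1F ∷ 4F ∷ 0F ∷ 3F ∷ 2F ∷ []) ∷
  (1F ∷ 4F ∷ 2F ∷ 0F ∷ 3F ∷ []) ∷
  (1F ∷ 4F ∷ 3F ∷ 0F ∷ 2F ∷ []) ∷
  (1F ∷ 4F ∷ 3F ∷ 2F ∷ 0F ∷ []) ∷
  (2F ∷ 1F ∷ 3F ∷ 4F ∷ 0F ∷ []) ∷
  (2F ∷ 1F ∷ 4F ∷ 0F ∷ 3F ∷ []) ∷
  (2F ∷ 3F ∷ 0F ∷ 4F ∷ 1F ∷ []) ∷
  (2F ∷ 3F ∷ 1F ∷ 0F ∷ 4F ∷ []) ∷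
  (2F ∷ 3F ∷ 4F ∷ 1F ∷ 0F ∷ []) ∷
  (2F ∷ 4F ∷ 1F ∷ 3F ∷ 0F ∷ []) ∷
  (2F ∷ 4F ∷ 3F ∷ 0F ∷ 1F ∷ []) ∷
  (3F ∷ 1F ∷ 4F ∷ 2F ∷ 0F ∷ []) ∷
  (3F ∷ 2F ∷ 1F ∷ 4F ∷ 0F ∷ []) ∷
  (3F ∷ 2F ∷ 4F ∷ 0F ∷ 1F ∷ []) ∷
  (3F ∷ 4F ∷ 2F ∷ 1F ∷ 0F ∷ []) ∷
  (4F ∷ 2F ∷ 3F ∷ 1F ∷ 0F ∷ []) ∷
  []

module Tail (h m : ℕ) where

  FixesTail : Sym (h + m) → Set
  FixesTail x = ∀ j → x ⟨$⟩ʳ (h ↑ʳ j) ≡ h ↑ʳ j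

  ∘-fixesTail : ∀ {x y} → FixesTail x → FixesTail y → FixesTail (x ∘ₚ y)
  ∘-fixesTail {y = y} x-fixes y-fixes j = trans (cong (y ⟨$⟩ʳ_) (x-fixes j)) (y-fixes j)

  ^-fixesTail : ∀ {x} k → FixesTail x → FixesTail (x ^ k)
  ^-fixesTail zero    x-fixes j = refl
  ^-fixesTail {x} (suc k) x-fixes = ∘-fixesTail {x} {x ^ k} x-fixes (^-fixesTail k x-fixes)

  _≈ʰ_ : Sym (h + m) → Sym (h + m) → Set
  x ≈ʰ y = ∀ i → x ⟨$⟩ʳ (i ↑ˡ m) ≡ y ⟨$⟩ʳ (i ↑ˡ m)

  _≈ʰ?_ : ∀ x y → Dec (x ≈ʰ y)
  x ≈ʰ? y = all? λ i → x ⟨$⟩ʳ (i ↑ˡ m) ≟ y ⟨$⟩ʳ (i ↑ˡ m)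

  ≈ʰ⇒≈ₚ : ∀ {x y} → FixesTail x → FixesTail y → x ≈ʰ y → x ≈ₚ y
  ≈ʰ⇒≈ₚ {x} {y} x-fixes y-fixes x≈ʰy i with splitAt h i in eq
  ... | inj₁ a = subst (λ k → x ⟨$⟩ʳ k ≡ y ⟨$⟩ʳ k) (splitAt⁻¹-↑ˡ eq) (x≈ʰy a)
  ... | inj₂ b =
    subst (λ k → x ⟨$⟩ʳ k ≡ y ⟨$⟩ʳ k) (splitAt⁻¹-↑ʳ eq) (trans (x-fixes b) (sym (y-fixes b)))

  ≈ₚ⇒≈ʰ : ∀ {x y} → x ≈ₚ y → x ≈ʰ y
  ≈ₚ⇒≈ʰ x≈y i = x≈y (i ↑ˡ m)

module Hexagon (m : ℕ) where
  open Tail 6 m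

  -- transpose a b ∘ₚ transpose a c is the 3-cycle (a b c), as ∘ₚ applies its left argument first.
  v : Fin 6 → Sym (6 + m)
  v 0F = transpose 4F 5F
  v 1F = transpose 0F 1F ∘ₚ transpose 0F 2F
  v 2F = transpose 3F 5F
  v 3F = transpose 1F 4F ∘ₚ transpose 1F 2F
  v 4F = transpose 0F 5F
  v 5F = transpose 1F 3F ∘ₚ transpose 1F 2F

  v-fixesTail : ∀ i → FixesTail (v i)
  v-fixesTail 0F _ = refl
  v-fixesTail 1F _ = refl
  v-fixesTail 2F _ = refl
  v-fixesTail 3F _ = refl
  v-fixesTail 4F _ = refl
  v-fixesTail 5F _ = refl

  CycAdj₆ : Fin 6 → Fin 6 → Set
  CycAdj₆ = CycAdj (EnhancedPowerGraphSym (6 + m)) 6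

  cycAdj₆? : ∀ i j → Dec (CycAdj₆ i j)
  cycAdj₆? i j = (toℕ j ℕ.≟ suc (toℕ i) % 6) ⊎-dec (toℕ i ℕ.≟ suc (toℕ j) % 6)

  PowersOfProduct : Fin 6 → Fin 6 → Set
  PowersOfProduct i j = Σ (Fin 7) λ a → Σ (Fin 7) λ b →
    v i ≈ʰ (v i ∘ₚ v j) ^ toℕ a × v j ≈ʰ (v i ∘ₚ v j) ^ toℕ b

  Shape : Fin 6 → Fin 6 → Set
  Shape i j = i ≡ j × ¬ CycAdj₆ i j
    ⊎ ¬ v i ≈ʰ v j × (CycAdj₆ i j × PowersOfProduct i j
                       ⊎ ¬ CycAdj₆ i j × ¬ (v i ∘ₚ v j) ≈ʰ (v j ∘ₚ v i))

  shape? : ∀ i j → Dec (Shape i j)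
  shape? i j = (i ≟ j ×-dec ¬? (cycAdj₆? i j))
    ⊎-dec ¬? (v i ≈ʰ? v j) ×-dec (cycAdj₆? i j ×-dec powersOfProduct?
                                   ⊎-dec ¬? (cycAdj₆? i j) ×-dec ¬? ((v i ∘ₚ v j) ≈ʰ? (v j ∘ₚ v i)))
    where
    powersOfProduct? = any? λ a → any? λ b →
      (v i ≈ʰ? (v i ∘ₚ v j) ^ toℕ a) ×-dec (v j ≈ʰ? (v i ∘ₚ v j) ^ toℕ b)

  shape : ∀ i j → Shape i j
  shape = toWitness {a? = all? λ i → all? λ j → shape? i j} tt

  private
    _~_ = Graph._~_ (EnhancedPowerGraphSym (6 + m))

  powerOfProduct-fixesTail : ∀ i j k → FixesTail ((v i ∘ₚ v j) ^ k)
  powerOfProduct-fixesTail i j k =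
    ^-fixesTail k (∘-fixesTail {v i} {v j} (v-fixesTail i) (v-fixesTail j))

  distinct-if-shape : ∀ {i j} → Shape i j → ¬ i ≡ j → ¬ v i ≈ₚ v j
  distinct-if-shape         (inj₁ (i≡j , _))    i≢j = ⊥-elim (i≢j i≡j)
  distinct-if-shape {i} {j} (inj₂ (vi≉ʰvj , _)) _   = λ vi≈vj → vi≉ʰvj (≈ₚ⇒≈ʰ {v i} {v j} vi≈vj)

  adjacent-if-shape : ∀ {i j} → Shape i j → (v i ~ v j) ⇔ CycAdj₆ i j
  adjacent-if-shape (inj₁ (refl , ¬adj)) =
    mk⇔ (λ (vi≉vi , _) → ⊥-elim (vi≉vi λ _ → refl)) (λ adj → ⊥-elim (¬adj adj))
  adjacent-if-shape {i} {j} (inj₂ (vi≉ʰvj , inj₁ (adj , a , b , vi≈ , vj≈))) = mk⇔ (λ _ → adj) λ _ →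
    adjacent-if-powers-of-product (toℕ a) (toℕ b) (λ vi≈vj → vi≉ʰvj (≈ₚ⇒≈ʰ {v i} {v j} vi≈vj))
      (≈ʰ⇒≈ₚ {v i} {(v i ∘ₚ v j) ^ toℕ a} (v-fixesTail i) (powerOfProduct-fixesTail i j (toℕ a)) vi≈)
      (≈ʰ⇒≈ₚ {v j} {(v i ∘ₚ v j) ^ toℕ b} (v-fixesTail j) (powerOfProduct-fixesTail i j (toℕ b)) vj≈)
  adjacent-if-shape {i} {j} (inj₂ (_ , inj₂ (¬adj , ¬comm))) = mk⇔
    (λ vi~vj → ⊥-elim (nonadjacent-if-not-commute (λ comm → ¬comm (≈ₚ⇒≈ʰ {v i ∘ₚ v j} {v j ∘ₚ v i} comm))
                                                  vi~vj))
    (λ adj → ⊥-elim (¬adj adj))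

  inducedHexagon : InducedCycle (EnhancedPowerGraphSym (6 + m)) 6
  inducedHexagon = v , (λ i j → distinct-if-shape (shape i j)) , (λ i j → adjacent-if-shape (shape i j))

transitiveOffDominating-upTo5 : ∀ {n} → n ≤ 5 → TransitiveOffDominating (EnhancedPowerGraphSym n)
transitiveOffDominating-upTo5 {0} _ = byCertificate maximalCyclicGenerators₀
transitiveOffDominating-upTo5 {1} _ = byCertificate maximalCyclicGenerators₁
transitiveOffDominating-upTo5 {2} _ = byCertificate maximalCyclicGenerators₂
transitiveOffDominating-upTo5 {3} _ = byCertificate maximalCyclicGenerators₃
transitiveOffDominating-upTo5 {4} _ = byCertificate maximalCyclicGenerators₄
transitiveOffDominating-upTo5 {5} _ = byCertificate maximalCyclicGenerators₅
transitiveOffDominating-upTo5 {suc (suc (suc (suc (suc (suc _)))))} (s≤s (s≤s (s≤s (s≤s (s≤s ())))))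

proposition4p11 : (n : ℕ) → 1 ≤ n →
    (IsCograph (EnhancedPowerGraphSym n) ⇔ IsChordal (EnhancedPowerGraphSym n)) ×
    (IsChordal (EnhancedPowerGraphSym n) ⇔ n ≤ 5)
proposition4p11 n _ with n ≤? 5
... | yes n≤5 = mk⇔ (λ _ → chordal) (λ _ → cograph) , mk⇔ (λ _ → n≤5) (λ _ → chordal)
  where
  transitive = transitiveOffDominating-upTo5 n≤5
  chordal = transitiveOffDominating⇒chordal (EnhancedPowerGraphSym n) transitive
  cograph = transitiveOffDominating⇒cograph (EnhancedPowerGraphSym n) transitive
... | no n≰5 with ℕ.m≤n⇒∃[o]m+o≡n (ℕ.≰⇒> n≰5)
... | m , refl = mk⇔ (λ c → ⊥-elim (notCograph c)) (λ c → ⊥-elim (notChordal c)) ,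
                 mk⇔ (λ c → ⊥-elim (notChordal c)) (λ n≤5 → ⊥-elim (n≰5 n≤5))
  where
  hexagon = Hexagon.inducedHexagon m
  notChordal : ¬ IsChordal (EnhancedPowerGraphSym (6 + m))
  notChordal chordal = chordal 2 hexagon
  notCograph : ¬ IsCograph (EnhancedPowerGraphSym (6 + m))
  notCograph cograph = cograph (inducedCycle⇒P4 (EnhancedPowerGraphSym (6 + m)) 1 hexagon)
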